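{- For every integer $d\geq 1$, every positive integer $n$, and every nontrivial $(d-1)$-cycle $Z$ over $\mathbb{F}_2$ on $[n]$, there exists a collapsible $d$-forest $F$ on $[n]$ such that $\partial F = Z$ and $\binom{n-1}{d} - |F| \leq \binom{n-1}{d-2}$. Moreover, there are at least $n-2d$ different such $F$.
   Context: All chains are over $\mathbb{F}_2$ and identified with their supports (sets of simplices); addition is symmetric difference. A $k$-simplex is a $(k+1)$-element subset of $[n]$. The boundary $\partial X$ of a set $X$ of $k$-simplices is the set of $(k-1)$-simplices contained in an odd number of members of $X$. A set $Z$ of $k$-simplices is a $k$-cycle if $\partial Z=\emptyset$; nontrivial means nonempty. A set $F$ of $d$-simplices is a $d$-forest if no nonempty subset of $F$ is a $d$-cycle. Convention: $\binom{n}{k}=0$ for $k<0$. Collapsibility: in the simplicial complex generated by (the subset-closure of) a set $F$ of $d$-simplices, a $(d-1)$-face $\tau$ is exposed if it lies in exactly one $d$-face $\sigma$; an elementary collapse removes $\sigma$ and $\tau$; $F$ is collapsible if all its $d$-faces can be removed by a sequence of elementary collapses. -}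

module Defs where

open import Data.Bool using (Bool; true; false; _∧_; _∨_; not; if_then_else_)
open import Data.Nat using (ℕ; zero; suc; _≡ᵇ_)
open import Data.Nat.Combinatorics using (_C_)
open import Data.Integer using (ℤ; +_; -[1+_])
open import Data.List using (List; []; _∷_; _++_; map)
open import Data.Vec using (Vec; []; _∷_)
open import Data.Fin.Subset using (Subset; ∣_∣)
open import Data.Product using (∃; _×_)
open import Relation.Binary.PropositionalEquality using (_≡_; _≢_)
open import Relation.Nullary using (¬_)

-- A simplex on [n] is a nonempty subset of Fin n; a k-simplex has k+1 elements.
-- A chain (set of simplices) on [n] is given by its (Boolean) indicator function.
Chain : ℕ → Set
Chain n = Subset n → Bool

allSubsets : (n : ℕ) → List (Subset n)
allSubsets zero = [] ∷ []
allSubsets (suc n) = map (false ∷_) (allSubsets n) ++ map (true ∷_) (allSubsets n)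

count : {A : Set} → (A → Bool) → List A → ℕ
count p [] = 0
count p (x ∷ xs) = if p x then suc (count p xs) else count p xs

odd : ℕ → Bool
odd zero = false
odd (suc k) = not (odd k)

_⊆ᵇ_ : {n : ℕ} → Subset n → Subset n → Bool
[] ⊆ᵇ [] = true
(x ∷ xs) ⊆ᵇ (y ∷ ys) = (not x ∨ y) ∧ (xs ⊆ᵇ ys)

_=ᵇ_ : {n : ℕ} → Subset n → Subset n → Bool
[] =ᵇ [] = true
(x ∷ xs) =ᵇ (y ∷ ys) = (if x then y else not y) ∧ (xs =ᵇ ys)

card : {n : ℕ} → Chain n → ℕ
card {n} X = count X (allSubsets n)

OfDim : {n : ℕ} → ℕ → Chain n → Set
OfDim {n} k X = ∀ σ → X σ ≡ true → ∣ σ ∣ ≡ suc k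

∂ : {n : ℕ} → Chain n → Chain n
∂ {n} X τ = odd (count (λ σ → X σ ∧ ((τ ⊆ᵇ σ) ∧ (∣ σ ∣ ≡ᵇ suc ∣ τ ∣))) (allSubsets n))

Empty : {n : ℕ} → Chain n → Set
Empty X = ∀ σ → X σ ≡ false

Nonempty : {n : ℕ} → Chain n → Set
Nonempty X = ∃ λ σ → X σ ≡ true

IsCycle : {n : ℕ} → Chain n → Set
IsCycle Z = Empty (∂ Z)

_⊑_ : {n : ℕ} → Chain n → Chain n → Set
S ⊑ F = ∀ σ → S σ ≡ true → F σ ≡ true

IsForest : {n : ℕ} → ℕ → Chain n → Set
IsForest {n} d F = OfDim d F × (∀ (S : Chain n) → S ⊑ F → Nonempty S → ¬ IsCycle S)

remove : {n : ℕ} → Chain n → Subset n → Chain n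
remove F σ ρ = F ρ ∧ not (ρ =ᵇ σ)

-- Collapsibility of a set of top-dimensional faces via elementary collapses:
-- a facet τ of σ ∈ F (one vertex fewer) is exposed if σ is the only member
-- of F containing it; the collapse removes σ (and τ).
data Collapsible {n : ℕ} : Chain n → Set where
  done : ∀ {F} → Empty F → Collapsible F
  collapse : ∀ {F} (σ τ : Subset n) → F σ ≡ true → (τ ⊆ᵇ σ) ≡ true → ∣ σ ∣ ≡ suc ∣ τ ∣ →
             (∀ ρ → F ρ ≡ true → (τ ⊆ᵇ ρ) ≡ true → ρ ≡ σ) →
             Collapsible (remove F σ) → Collapsible F

binomℤ : ℕ → ℤ → ℕ
binomℤ n (+ k) = n C k
binomℤ n -[1+ _ ] = 0

Distinct : {n : ℕ} → Chain n → Chain n → Set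
Distinct F G = ∃ λ σ → F σ ≢ G σ

module Submission where

-- Proof, by induction on n and then on d.  Splitting at vertex 0, a chain is 0 ∗ A + B with
-- A its link and B its deletion, and ∂ (0 ∗ A + B) = 0 ∗ ∂A + (A + ∂B).  After relabelling
-- by adjacent transpositions (which preserve everything in sight) vertex 0 lies in Z; then
-- the link L of Z is a cycle on the other vertices and ∂ (deletion Z) = L.  Each filling A
-- of L makes deletion Z + A a cycle; filling it by B gives the filling 0 ∗ A + B of Z, which
-- is collapsible when A and B are, and Pascal's rule propagates the bound.  Distinct A give
-- distinct fillings.  At most one A leaves deletion Z + A empty; then the cone 0 ∗ A alone
-- fills Z, within the bound if n - 2 ≤ 2(d-1), and otherwise that A is dropped, which still
-- leaves (n-1) - 2(d-1) - 1 = n - 2d fillings.  In dimension 0 the cycle is {∅}, filled by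
-- any single vertex.

open import Defs
open import Algebra using (CommutativeRing)
import Algebra.Properties.CommutativeSemigroup as CommSemigroupProperties
open import Data.Bool using (Bool; true; false; _∧_; _∨_; not; if_then_else_; _xor_)
open import Data.Bool.Properties
  using (¬-not; not-¬; ∧-zeroʳ; ∧-identityʳ; ∧-inverseʳ; ∧-distribʳ-xor; not-distribˡ-xor; xor-same;
         xor-identityʳ; xor-assoc; xor-∧-commutativeRing; T-≡)
open import Data.Empty using (⊥; ⊥-elim)
open import Data.Fin using (Fin)
open import Data.Fin.Subset using (Subset; ∣_∣; ⁅_⁆; _∈_) renaming (⊥ to ∅)
open import Data.Fin.Subset.Properties using (∣⊥∣≡0; ∣⁅x⁆∣≡1; x∈⁅x⁆; x∈⁅y⁆⇒x≡y)
open import Data.Integer using (+_; _-_; _⊖_; +≤+) renaming (_≤_ to _≤ℤ_)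
open import Data.Integer.Properties using (⊖-≥; ⊖-≤; m-n≡m⊖n; neg-≤-pos)
open import Data.List using (List; []; _∷_; _++_; map; length; tabulate)
open import Data.List.Properties using (length-map; length-tabulate)
open import Data.List.Relation.Unary.All using (All; []; _∷_)
import Data.List.Relation.Unary.All as All
import Data.List.Relation.Unary.All.Properties as All
open import Data.List.Relation.Unary.AllPairs using (AllPairs; []; _∷_)
import Data.List.Relation.Unary.AllPairs as AllPairs
import Data.List.Relation.Unary.AllPairs.Properties as AllPairs
open import Data.List.Relation.Unary.Any using (Any; here; there)
open import Data.Nat using (ℕ; zero; suc; _+_; _≤_; _∸_; _*_; _≡ᵇ_; z≤n; s≤s; _≤?_)
open import Data.Nat.Combinatorics using (_C_; nCk≡nC[n∸k]; nCk+nC[k+1]≡[n+1]C[k+1]; k>n⇒nCk≡0)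
open import Data.Nat.Properties
  using (+-identityʳ; +-comm; +-assoc; +-suc; *-suc; +-commutativeSemigroup; suc-injective; 0≢1+n; 1+n≢0;
         ≤-refl; ≤-trans; ≤-reflexive; ≤-antisym; ≤-pred; ≰⇒>; <⇒≤; n≤1+n; m≤n⇒m≤1+n; 1+n≰n; m≤m+n; m≤n+m;
         +-mono-≤; +-monoʳ-≤; +-monoˡ-≤; +-cancelˡ-≤; m+n∸n≡m; m+[n∸m]≡n; m≤n⇒m∸n≡0; m<n⇒0<n∸m;
         m≤n+o⇒m∸n≤o; ≡ᵇ⇒≡; ≡⇒≡ᵇ; module ≤-Reasoning)
open import Data.Product using (Σ; ∃; _×_; _,_; proj₁; proj₂)
open import Data.Sum using (_⊎_; inj₁; inj₂)
open import Data.Vec using ([]; _∷_)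
open import Data.Vec.Properties using (∷-injectiveʳ)
open import Function using (_∘_; Equivalence)
open import Relation.Binary.PropositionalEquality
open import Relation.Nullary using (¬_; yes; no)

count-++ : {A : Set} (p : A → Bool) (xs ys : List A) → count p (xs ++ ys) ≡ count p xs + count p ys
count-++ p [] ys = refl
count-++ p (x ∷ xs) ys with p x
... | true = cong suc (count-++ p xs ys)
... | false = count-++ p xs ys

count-map : {A B : Set} (p : B → Bool) (f : A → B) (xs : List A) → count p (map f xs) ≡ count (p ∘ f) xs
count-map p f [] = refl
count-map p f (x ∷ xs) with p (f x)
... | true = cong suc (count-map p f xs)
... | false = count-map p f xs

count-cong : {A : Set} {p q : A → Bool} → (∀ x → p x ≡ q x) → (xs : List A) → count p xs ≡ count q xs
count-cong p≗q [] = refl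
count-cong {q = q} p≗q (x ∷ xs) rewrite p≗q x with q x
... | true = cong suc (count-cong p≗q xs)
... | false = count-cong p≗q xs

count-none : {A : Set} {p : A → Bool} → (∀ x → p x ≡ false) → (xs : List A) → count p xs ≡ 0
count-none never [] = refl
count-none never (x ∷ xs) rewrite never x = count-none never xs

count-allSubsets-suc : ∀ {n} (p : Subset (suc n) → Bool) →
  count p (allSubsets (suc n)) ≡ count (p ∘ (false ∷_)) (allSubsets n) + count (p ∘ (true ∷_)) (allSubsets n)
count-allSubsets-suc {n} p = begin
  count p (map (false ∷_) (allSubsets n) ++ map (true ∷_) (allSubsets n))
    ≡⟨ count-++ p (map (false ∷_) (allSubsets n)) _ ⟩
  count p (map (false ∷_) (allSubsets n)) + count p (map (true ∷_) (allSubsets n))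
    ≡⟨ cong₂ _+_ (count-map p (false ∷_) (allSubsets n)) (count-map p (true ∷_) (allSubsets n)) ⟩
  count (p ∘ (false ∷_)) (allSubsets n) + count (p ∘ (true ∷_)) (allSubsets n) ∎
  where open ≡-Reasoning

count-unique : ∀ {n} (t : Subset n) (p : Subset n → Bool) → (∀ s → p s ≡ true → s ≡ t) →
  count p (allSubsets n) ≡ (if p t then 1 else 0)
count-unique {zero} [] p only with p []
... | true = refl
... | false = refl
count-unique {suc n} (false ∷ t) p only = begin
  count p (allSubsets (suc n))
    ≡⟨ count-allSubsets-suc p ⟩
  count (p ∘ (false ∷_)) (allSubsets n) + count (p ∘ (true ∷_)) (allSubsets n)
    ≡⟨ cong₂ _+_ (count-unique t (p ∘ (false ∷_)) (λ s → ∷-injectiveʳ ∘ only _))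
                 (count-none (λ s → ¬-not (λ ps → ≢-head (only _ ps))) (allSubsets n)) ⟩
  (if p (false ∷ t) then 1 else 0) + 0
    ≡⟨ +-identityʳ _ ⟩
  (if p (false ∷ t) then 1 else 0) ∎
  where open ≡-Reasoning
        ≢-head : ∀ {s} → ¬ (true ∷ s ≡ false ∷ t)
        ≢-head ()
count-unique {suc n} (true ∷ t) p only = begin
  count p (allSubsets (suc n))
    ≡⟨ count-allSubsets-suc p ⟩
  count (p ∘ (false ∷_)) (allSubsets n) + count (p ∘ (true ∷_)) (allSubsets n)
    ≡⟨ cong₂ _+_ (count-none (λ s → ¬-not (λ ps → ≢-head (only _ ps))) (allSubsets n))
                 (count-unique t (p ∘ (true ∷_)) (λ s → ∷-injectiveʳ ∘ only _)) ⟩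
  (if p (true ∷ t) then 1 else 0) ∎
  where open ≡-Reasoning
        ≢-head : ∀ {s} → ¬ (false ∷ s ≡ true ∷ t)
        ≢-head ()

odd-+ : ∀ a b → odd (a + b) ≡ odd a xor odd b
odd-+ zero b = refl
odd-+ (suc a) b rewrite odd-+ a b = not-distribˡ-xor (odd a) (odd b)

odd-if : ∀ c → odd (if c then 1 else 0) ≡ c
odd-if true = refl
odd-if false = refl

odd-count-∷ : {A : Set} (p : A → Bool) (x : A) (xs : List A) → odd (count p (x ∷ xs)) ≡ p x xor odd (count p xs)
odd-count-∷ p x xs with p x
... | true = refl
... | false = refl

odd-count-xor : {A : Set} (p q : A → Bool) (xs : List A) →
  odd (count (λ x → p x xor q x) xs) ≡ odd (count p xs) xor odd (count q xs)
odd-count-xor p q [] = refl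
odd-count-xor p q (x ∷ xs) = begin
  odd (count pq (x ∷ xs))                                        ≡⟨ odd-count-∷ pq x xs ⟩
  (p x xor q x) xor odd (count pq xs)                            ≡⟨ cong ((p x xor q x) xor_) (odd-count-xor p q xs) ⟩
  (p x xor q x) xor (odd (count p xs) xor odd (count q xs))      ≡⟨ interchange (p x) (q x) _ _ ⟩
  (p x xor odd (count p xs)) xor (q x xor odd (count q xs))      ≡⟨ sym (cong₂ _xor_ (odd-count-∷ p x xs) (odd-count-∷ q x xs)) ⟩
  odd (count p (x ∷ xs)) xor odd (count q (x ∷ xs))              ∎
  where open ≡-Reasoning
        open CommSemigroupProperties (CommutativeRing.+-commutativeSemigroup xor-∧-commutativeRing) using (interchange)
        pq = λ y → p y xor q y

⊆ᵇ-refl : ∀ {n} (t : Subset n) → (t ⊆ᵇ t) ≡ true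
⊆ᵇ-refl [] = refl
⊆ᵇ-refl (true ∷ t) = ⊆ᵇ-refl t
⊆ᵇ-refl (false ∷ t) = ⊆ᵇ-refl t

⊆ᵇ⇒∣≤∣ : ∀ {n} (t s : Subset n) → (t ⊆ᵇ s) ≡ true → ∣ t ∣ ≤ ∣ s ∣
⊆ᵇ⇒∣≤∣ [] [] _ = z≤n
⊆ᵇ⇒∣≤∣ (true ∷ t) (true ∷ s) t⊆s = s≤s (⊆ᵇ⇒∣≤∣ t s t⊆s)
⊆ᵇ⇒∣≤∣ (false ∷ t) (true ∷ s) t⊆s = m≤n⇒m≤1+n (⊆ᵇ⇒∣≤∣ t s t⊆s)
⊆ᵇ⇒∣≤∣ (false ∷ t) (false ∷ s) t⊆s = ⊆ᵇ⇒∣≤∣ t s t⊆s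

⊆ᵇ-∣≡∣⇒≡ : ∀ {n} (t s : Subset n) → (t ⊆ᵇ s) ≡ true → ∣ s ∣ ≡ ∣ t ∣ → s ≡ t
⊆ᵇ-∣≡∣⇒≡ [] [] _ _ = refl
⊆ᵇ-∣≡∣⇒≡ (true ∷ t) (true ∷ s) t⊆s eq = cong (true ∷_) (⊆ᵇ-∣≡∣⇒≡ t s t⊆s (suc-injective eq))
⊆ᵇ-∣≡∣⇒≡ (false ∷ t) (false ∷ s) t⊆s eq = cong (false ∷_) (⊆ᵇ-∣≡∣⇒≡ t s t⊆s eq)
⊆ᵇ-∣≡∣⇒≡ (false ∷ t) (true ∷ s) t⊆s eq = ⊥-elim (1+n≰n (subst (_≤ ∣ s ∣) (sym eq) (⊆ᵇ⇒∣≤∣ t s t⊆s)))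

∣∣≡0⇒⊆ᵇ : ∀ {n} (t s : Subset n) → ∣ t ∣ ≡ 0 → (t ⊆ᵇ s) ≡ true
∣∣≡0⇒⊆ᵇ [] [] _ = refl
∣∣≡0⇒⊆ᵇ (false ∷ t) (_ ∷ s) eq = ∣∣≡0⇒⊆ᵇ t s eq

=ᵇ-refl : ∀ {n} (t : Subset n) → (t =ᵇ t) ≡ true
=ᵇ-refl [] = refl
=ᵇ-refl (true ∷ t) = =ᵇ-refl t
=ᵇ-refl (false ∷ t) = =ᵇ-refl t

=ᵇ⇒≡ : ∀ {n} (t s : Subset n) → (t =ᵇ s) ≡ true → t ≡ s
=ᵇ⇒≡ [] [] _ = refl
=ᵇ⇒≡ (true ∷ t) (true ∷ s) eq = cong (true ∷_) (=ᵇ⇒≡ t s eq)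
=ᵇ⇒≡ (false ∷ t) (false ∷ s) eq = cong (false ∷_) (=ᵇ⇒≡ t s eq)

≢⇒=ᵇ-false : ∀ {n} (t s : Subset n) → ¬ (t ≡ s) → (t =ᵇ s) ≡ false
≢⇒=ᵇ-false t s t≢s = ¬-not (t≢s ∘ =ᵇ⇒≡ t s)

infix 4 _≐_
_≐_ : ∀ {n} → Chain n → Chain n → Set
X ≐ Y = ∀ σ → X σ ≡ Y σ

∅ᶜ : ∀ {n} → Chain n
∅ᶜ _ = false

infixl 6 _⊕_
_⊕_ : ∀ {n} → Chain n → Chain n → Chain n
(X ⊕ Y) σ = X σ xor Y σ

IsFacet : ∀ {n} → Subset n → Subset n → Bool
IsFacet τ σ = (τ ⊆ᵇ σ) ∧ (∣ σ ∣ ≡ᵇ suc ∣ τ ∣)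

∧-true⁻ : ∀ {a b} → (a ∧ b) ≡ true → a ≡ true × b ≡ true
∧-true⁻ {true} {true} _ = refl , refl

≡ᵇ-refl : ∀ k → (k ≡ᵇ k) ≡ true
≡ᵇ-refl k = Equivalence.to T-≡ (≡⇒≡ᵇ k k refl)

≡ᵇ-true⇒≡ : ∀ m k → (m ≡ᵇ k) ≡ true → m ≡ k
≡ᵇ-true⇒≡ m k eq = ≡ᵇ⇒≡ m k (Equivalence.from T-≡ eq)

xor≡false⇒≡ : ∀ {a b} → (a xor b) ≡ false → a ≡ b
xor≡false⇒≡ {true} {true} _ = refl
xor≡false⇒≡ {false} {false} _ = refl

∂-cong : ∀ {n} {X Y : Chain n} → X ≐ Y → ∂ X ≐ ∂ Y
∂-cong {n} X≐Y τ = cong odd (count-cong (λ σ → cong (_∧ IsFacet τ σ) (X≐Y σ)) (allSubsets n))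

∂-⊕ : ∀ {n} (X Y : Chain n) → ∂ (X ⊕ Y) ≐ ∂ X ⊕ ∂ Y
∂-⊕ {n} X Y τ = begin
  odd (count (λ σ → (X σ xor Y σ) ∧ IsFacet τ σ) (allSubsets n))
    ≡⟨ cong odd (count-cong (λ σ → ∧-distribʳ-xor (IsFacet τ σ) (X σ) (Y σ)) (allSubsets n)) ⟩
  odd (count (λ σ → (X σ ∧ IsFacet τ σ) xor (Y σ ∧ IsFacet τ σ)) (allSubsets n))
    ≡⟨ odd-count-xor (λ σ → X σ ∧ IsFacet τ σ) (λ σ → Y σ ∧ IsFacet τ σ) (allSubsets n) ⟩
  ∂ X τ xor ∂ Y τ ∎
  where open ≡-Reasoning

∂-∅ : ∀ {n} → ∂ {n} ∅ᶜ ≐ ∅ᶜ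
∂-∅ {n} τ = cong odd (count-none (λ _ → refl) (allSubsets n))

∂-unique : ∀ {n} (X : Chain n) (τ σ : Subset n) → (∀ ρ → (X ρ ∧ IsFacet τ ρ) ≡ true → ρ ≡ σ) →
  ∂ X τ ≡ (X σ ∧ IsFacet τ σ)
∂-unique X τ σ only = trans (cong odd (count-unique σ (λ ρ → X ρ ∧ IsFacet τ ρ) only)) (odd-if _)

-- Cone decomposition at vertex 0: a chain on {0} ⊔ [n] is determined by its link A at 0
-- (the faces through 0, with 0 removed) and its deletion B (the faces avoiding 0);
-- coneSum A B is the chain 0 ∗ A + B.

link : ∀ {n} → Chain (suc n) → Chain n
link X s = X (true ∷ s)

deletion : ∀ {n} → Chain (suc n) → Chain n
deletion X s = X (false ∷ s)

coneSum : ∀ {n} → Chain n → Chain n → Chain (suc n)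
coneSum A B (false ∷ s) = B s
coneSum A B (true ∷ s) = A s

coneSum-split : ∀ {n} (X : Chain (suc n)) → X ≐ coneSum (link X) (deletion X)
coneSum-split X (false ∷ s) = refl
coneSum-split X (true ∷ s) = refl

nonempty⊎empty : ∀ {n} (X : Chain n) → Nonempty X ⊎ Empty X
nonempty⊎empty {zero} X with X [] in X∅
... | true = inj₁ ([] , X∅)
... | false = inj₂ λ { [] → X∅ }
nonempty⊎empty {suc n} X with nonempty⊎empty (link X) | nonempty⊎empty (deletion X)
... | inj₁ (σ , Xσ) | _ = inj₁ (true ∷ σ , Xσ)
... | inj₂ _ | inj₁ (σ , Xσ) = inj₁ (false ∷ σ , Xσ)
... | inj₂ emptyLink | inj₂ emptyDeletion = inj₂ λ { (false ∷ s) → emptyDeletion s ; (true ∷ s) → emptyLink s }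

card-coneSum : ∀ {n} (A B : Chain n) → card (coneSum A B) ≡ card B + card A
card-coneSum A B = count-allSubsets-suc (coneSum A B)

-- ∂ (0 ∗ A + B) = 0 ∗ ∂ A + (A + ∂ B): at faces through 0 ...
∂-coneSum-link : ∀ {n} (A B : Chain n) t → ∂ (coneSum A B) (true ∷ t) ≡ ∂ A t
∂-coneSum-link {n} A B t = cong odd (begin
  count (λ σ → coneSum A B σ ∧ IsFacet (true ∷ t) σ) (allSubsets (suc n))
    ≡⟨ count-allSubsets-suc (λ σ → coneSum A B σ ∧ IsFacet (true ∷ t) σ) ⟩
  count (λ s → B s ∧ false) (allSubsets n) + count (λ s → A s ∧ IsFacet t s) (allSubsets n)
    ≡⟨ cong (_+ _) (count-none (λ s → ∧-zeroʳ (B s)) (allSubsets n)) ⟩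
  count (λ s → A s ∧ IsFacet t s) (allSubsets n) ∎)
  where open ≡-Reasoning

-- ... and at faces avoiding 0, where the only facet-incidence with 0 ∗ A is t ⊂ 0 ∗ t.
∂-coneSum-deletion : ∀ {n} (A B : Chain n) t → ∂ (coneSum A B) (false ∷ t) ≡ ∂ B t xor A t
∂-coneSum-deletion {n} A B t = begin
  odd (count (λ σ → coneSum A B σ ∧ IsFacet (false ∷ t) σ) (allSubsets (suc n)))
    ≡⟨ cong odd (count-allSubsets-suc (λ σ → coneSum A B σ ∧ IsFacet (false ∷ t) σ)) ⟩
  odd (count (λ s → B s ∧ IsFacet t s) (allSubsets n) + count apexed (allSubsets n))
    ≡⟨ odd-+ (count (λ s → B s ∧ IsFacet t s) (allSubsets n)) _ ⟩
  ∂ B t xor odd (count apexed (allSubsets n))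
    ≡⟨ cong (∂ B t xor_) (trans (cong odd (count-unique t apexed only-t)) (odd-if (apexed t))) ⟩
  ∂ B t xor apexed t
    ≡⟨ cong (λ b → ∂ B t xor (A t ∧ b)) (cong₂ _∧_ (⊆ᵇ-refl t) (≡ᵇ-refl ∣ t ∣)) ⟩
  ∂ B t xor (A t ∧ true)
    ≡⟨ cong (∂ B t xor_) (∧-identityʳ (A t)) ⟩
  ∂ B t xor A t ∎
  where
  open ≡-Reasoning
  -- s ∈ A such that 0 ∗ s has false ∷ t as a facet, i.e. s = t
  apexed : Subset n → Bool
  apexed s = A s ∧ ((t ⊆ᵇ s) ∧ (∣ s ∣ ≡ᵇ ∣ t ∣))
  only-t : ∀ s → apexed s ≡ true → s ≡ t
  only-t s eq with ∧-true⁻ {A s} eq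
  ... | _ , facet with ∧-true⁻ {t ⊆ᵇ s} facet
  ... | t⊆s , size = ⊆ᵇ-∣≡∣⇒≡ t s t⊆s (≡ᵇ-true⇒≡ ∣ s ∣ ∣ t ∣ size)

link-boundary : ∀ {n} (Z : Chain (suc n)) → IsCycle Z → ∂ (deletion Z) ≐ link Z
link-boundary Z cyc t = xor≡false⇒≡ (begin
  ∂ (deletion Z) t xor link Z t                        ≡⟨ sym (∂-coneSum-deletion (link Z) (deletion Z) t) ⟩
  ∂ (coneSum (link Z) (deletion Z)) (false ∷ t)        ≡⟨ sym (∂-cong (coneSum-split Z) (false ∷ t)) ⟩
  ∂ Z (false ∷ t)                                      ≡⟨ cyc (false ∷ t) ⟩
  false                                                ∎)
  where open ≡-Reasoning

link-cycle : ∀ {n} (Z : Chain (suc n)) → IsCycle Z → IsCycle (link Z)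
link-cycle Z cyc t = begin
  ∂ (link Z) t                                 ≡⟨ sym (∂-coneSum-link (link Z) (deletion Z) t) ⟩
  ∂ (coneSum (link Z) (deletion Z)) (true ∷ t) ≡⟨ sym (∂-cong (coneSum-split Z) (true ∷ t)) ⟩
  ∂ Z (true ∷ t)                               ≡⟨ cyc (true ∷ t) ⟩
  false                                        ∎
  where open ≡-Reasoning

Collapsible-cong : ∀ {n} {F G : Chain n} → Collapsible F → F ≐ G → Collapsible G
Collapsible-cong (done empty) F≐G = done (λ σ → trans (sym (F≐G σ)) (empty σ))
Collapsible-cong (collapse σ τ Fσ τ⊆σ size free rest) F≐G =
  collapse σ τ (trans (sym (F≐G σ)) Fσ) τ⊆σ size (λ ρ Gρ → free ρ (trans (F≐G ρ) Gρ))
    (Collapsible-cong rest (λ ρ → cong (_∧ _) (F≐G ρ)))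

exposed⇒∂ : ∀ {n} (S : Chain n) (σ τ : Subset n) → S σ ≡ true → (τ ⊆ᵇ σ) ≡ true → ∣ σ ∣ ≡ suc ∣ τ ∣ →
  (∀ ρ → S ρ ≡ true → (τ ⊆ᵇ ρ) ≡ true → ρ ≡ σ) → ∂ S τ ≡ true
exposed⇒∂ S σ τ Sσ τ⊆σ size free = begin
  ∂ S τ                    ≡⟨ ∂-unique S τ σ only-σ ⟩
  S σ ∧ IsFacet τ σ        ≡⟨ cong₂ (λ a b → a ∧ (b ∧ (∣ σ ∣ ≡ᵇ suc ∣ τ ∣))) Sσ τ⊆σ ⟩
  (∣ σ ∣ ≡ᵇ suc ∣ τ ∣)     ≡⟨ cong (_≡ᵇ suc ∣ τ ∣) size ⟩
  (suc ∣ τ ∣ ≡ᵇ suc ∣ τ ∣) ≡⟨ ≡ᵇ-refl (suc ∣ τ ∣) ⟩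
  true                     ∎
  where
  open ≡-Reasoning
  only-σ : ∀ ρ → (S ρ ∧ IsFacet τ ρ) ≡ true → ρ ≡ σ
  only-σ ρ inc with ∧-true⁻ {S ρ} inc
  ... | Sρ , facet = free ρ Sρ (proj₁ (∧-true⁻ {τ ⊆ᵇ ρ} facet))

-- A collapsible set of simplices contains no nonempty cycle: the first collapsed simplex σ
-- that lies in S has an exposed facet, which then lies in ∂ S.
collapsible⇒acyclic : ∀ {n} {F : Chain n} → Collapsible F → (S : Chain n) → S ⊑ F → Nonempty S → ¬ IsCycle S
collapsible⇒acyclic (done empty) S S⊑F (σ , Sσ) _ with () ← trans (sym (S⊑F σ Sσ)) (empty σ)
collapsible⇒acyclic {F = F} (collapse σ τ Fσ τ⊆σ size free rest) S S⊑F nonempty cyc with S σ in Sσ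
... | true with () ← trans (sym (exposed⇒∂ S σ τ Sσ τ⊆σ size (λ ρ → free ρ ∘ S⊑F ρ))) (cyc τ)
... | false = collapsible⇒acyclic rest S S⊑rest nonempty cyc
  where
  S⊑rest : S ⊑ remove F σ
  S⊑rest ρ Sρ rewrite S⊑F ρ Sρ = cong not (≢⇒=ᵇ-false ρ σ (λ ρ≡σ → not-¬ Sρ (trans (cong S ρ≡σ) Sσ)))

-- 0 ∗ A + B is collapsible when A and B are: first collapse each cone 0 ∗ σ through the
-- exposed face 0 ∗ τ (as σ collapses through τ in A), then collapse B.
collapsible-coneSum : ∀ {n} {A B : Chain n} → Collapsible A → Collapsible B → Collapsible (coneSum A B)
collapsible-coneSum {A = A} {B} (done emptyA) (done emptyB) = done empty
  where empty : ∀ σ → coneSum A B σ ≡ false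
        empty (false ∷ s) = emptyB s
        empty (true ∷ s) = emptyA s
collapsible-coneSum {A = A} {B} cA@(done emptyA) (collapse σ τ Bσ τ⊆σ size free rest) =
  collapse (false ∷ σ) (false ∷ τ) Bσ τ⊆σ size free′ (Collapsible-cong (collapsible-coneSum cA rest) removed)
  where
  free′ : ∀ ρ → coneSum A B ρ ≡ true → ((false ∷ τ) ⊆ᵇ ρ) ≡ true → ρ ≡ false ∷ σ
  free′ (false ∷ r) Br τ⊆r = cong (false ∷_) (free r Br τ⊆r)
  free′ (true ∷ r) Ar _ with () ← trans (sym Ar) (emptyA r)
  removed : coneSum A (remove B σ) ≐ remove (coneSum A B) (false ∷ σ)
  removed (false ∷ r) = refl
  removed (true ∷ r) = sym (∧-identityʳ (A r))
collapsible-coneSum {A = A} {B} (collapse σ τ Aσ τ⊆σ size free rest) cB =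
  collapse (true ∷ σ) (true ∷ τ) Aσ τ⊆σ (cong suc size) free′ (Collapsible-cong (collapsible-coneSum rest cB) removed)
  where
  free′ : ∀ ρ → coneSum A B ρ ≡ true → ((true ∷ τ) ⊆ᵇ ρ) ≡ true → ρ ≡ true ∷ σ
  free′ (true ∷ r) Ar τ⊆r = cong (true ∷_) (free r Ar τ⊆r)
  removed : coneSum (remove A σ) B ≐ remove (coneSum A B) (true ∷ σ)
  removed (false ∷ r) = sym (∧-identityʳ (B r))
  removed (true ∷ r) = refl

-- Relabelling vertices by the transposition of k and k + 1.  Transpositions preserve
-- inclusion and size, hence boundaries, cardinalities and collapsibility; composing them
-- moves any vertex to position 0, where the cone decomposition applies.

swapAt : ∀ {n} → ℕ → Subset n → Subset n
swapAt zero (a ∷ b ∷ s) = b ∷ a ∷ s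
swapAt zero s = s
swapAt (suc k) [] = []
swapAt (suc k) (a ∷ s) = a ∷ swapAt k s

swapAt-involutive : ∀ {n} k (s : Subset n) → swapAt k (swapAt k s) ≡ s
swapAt-involutive zero [] = refl
swapAt-involutive zero (a ∷ []) = refl
swapAt-involutive zero (a ∷ b ∷ s) = refl
swapAt-involutive (suc k) [] = refl
swapAt-involutive (suc k) (a ∷ s) = cong (a ∷_) (swapAt-involutive k s)

∣swapAt∣ : ∀ {n} k (s : Subset n) → ∣ swapAt k s ∣ ≡ ∣ s ∣
∣swapAt∣ zero [] = refl
∣swapAt∣ zero (a ∷ []) = refl
∣swapAt∣ zero (true ∷ true ∷ s) = refl
∣swapAt∣ zero (true ∷ false ∷ s) = refl
∣swapAt∣ zero (false ∷ true ∷ s) = refl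
∣swapAt∣ zero (false ∷ false ∷ s) = refl
∣swapAt∣ (suc k) [] = refl
∣swapAt∣ (suc k) (true ∷ s) = cong suc (∣swapAt∣ k s)
∣swapAt∣ (suc k) (false ∷ s) = ∣swapAt∣ k s

swapAt-⊆ᵇ : ∀ {n} k (s t : Subset n) → (swapAt k s ⊆ᵇ swapAt k t) ≡ (s ⊆ᵇ t)
swapAt-⊆ᵇ zero [] [] = refl
swapAt-⊆ᵇ zero (a ∷ []) (b ∷ []) = refl
swapAt-⊆ᵇ zero (a ∷ a′ ∷ s) (b ∷ b′ ∷ t) = ∧-swap (not a′ ∨ b′) (not a ∨ b) (s ⊆ᵇ t)
  where ∧-swap : ∀ x y z → (x ∧ (y ∧ z)) ≡ (y ∧ (x ∧ z))
        ∧-swap true y z = refl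
        ∧-swap false true z = refl
        ∧-swap false false z = refl
swapAt-⊆ᵇ (suc k) [] [] = refl
swapAt-⊆ᵇ (suc k) (a ∷ s) (b ∷ t) = cong ((not a ∨ b) ∧_) (swapAt-⊆ᵇ k s t)

swapAt-=ᵇ : ∀ {n} k (ρ σ : Subset n) → (swapAt k ρ =ᵇ σ) ≡ (ρ =ᵇ swapAt k σ)
swapAt-=ᵇ k ρ σ with swapAt k ρ =ᵇ σ in eq₁ | ρ =ᵇ swapAt k σ in eq₂
... | true | true = refl
... | false | false = refl
... | true | false with () ← trans (sym (=ᵇ-refl ρ))
      (trans (cong (ρ =ᵇ_) (trans (sym (swapAt-involutive k ρ)) (cong (swapAt k) (=ᵇ⇒≡ _ _ eq₁)))) eq₂)
... | false | true with () ← trans (sym (=ᵇ-refl σ))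
      (trans (cong (_=ᵇ σ) (trans (sym (swapAt-involutive k σ)) (cong (swapAt k) (sym (=ᵇ⇒≡ _ _ eq₂))))) eq₁)

count-swapAt : ∀ {n} k (p : Subset n → Bool) → count p (allSubsets n) ≡ count (p ∘ swapAt k) (allSubsets n)
count-swapAt {zero} zero p = refl
count-swapAt {zero} (suc k) p = refl
count-swapAt {suc zero} zero p = count-cong {p = p} {q = p ∘ swapAt zero} (λ { (a ∷ []) → refl }) (allSubsets 1)
count-swapAt {suc (suc n)} zero p = begin
  count p (allSubsets (suc (suc n)))
    ≡⟨ count-allSubsets-suc p ⟩
  count (p ∘ (false ∷_)) (allSubsets (suc n)) + count (p ∘ (true ∷_)) (allSubsets (suc n))
    ≡⟨ cong₂ _+_ (count-allSubsets-suc (p ∘ (false ∷_))) (count-allSubsets-suc (p ∘ (true ∷_))) ⟩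
  (# false false + # false true) + (# true false + # true true)
    ≡⟨ interchange (# false false) (# false true) (# true false) (# true true) ⟩
  (# false false + # true false) + (# false true + # true true)
    ≡⟨ sym (cong₂ _+_ (count-allSubsets-suc (p ∘ swapAt zero ∘ (false ∷_)))
                      (count-allSubsets-suc (p ∘ swapAt zero ∘ (true ∷_)))) ⟩
  count (p ∘ swapAt zero ∘ (false ∷_)) (allSubsets (suc n)) + count (p ∘ swapAt zero ∘ (true ∷_)) (allSubsets (suc n))
    ≡⟨ sym (count-allSubsets-suc (p ∘ swapAt zero)) ⟩
  count (p ∘ swapAt zero) (allSubsets (suc (suc n))) ∎
  where
  open ≡-Reasoning
  open CommSemigroupProperties +-commutativeSemigroup using (interchange)
  # : Bool → Bool → ℕ
  # a b = count (λ s → p (a ∷ b ∷ s)) (allSubsets n)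
count-swapAt {suc n} (suc k) p = begin
  count p (allSubsets (suc n))
    ≡⟨ count-allSubsets-suc p ⟩
  count (p ∘ (false ∷_)) (allSubsets n) + count (p ∘ (true ∷_)) (allSubsets n)
    ≡⟨ cong₂ _+_ (count-swapAt k (p ∘ (false ∷_))) (count-swapAt k (p ∘ (true ∷_))) ⟩
  count (p ∘ (false ∷_) ∘ swapAt k) (allSubsets n) + count (p ∘ (true ∷_) ∘ swapAt k) (allSubsets n)
    ≡⟨ sym (count-allSubsets-suc (p ∘ swapAt (suc k))) ⟩
  count (p ∘ swapAt (suc k)) (allSubsets (suc n)) ∎
  where open ≡-Reasoning

relabel : ∀ {n} → ℕ → Chain n → Chain n
relabel k X = X ∘ swapAt k

∂-relabel : ∀ {n} k (X : Chain n) → ∂ (relabel k X) ≐ relabel k (∂ X)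
∂-relabel {n} k X τ = sym (cong odd (begin
  count (λ σ → X σ ∧ IsFacet (swapAt k τ) σ) (allSubsets n)
    ≡⟨ count-swapAt k (λ σ → X σ ∧ IsFacet (swapAt k τ) σ) ⟩
  count (λ σ → X (swapAt k σ) ∧ IsFacet (swapAt k τ) (swapAt k σ)) (allSubsets n)
    ≡⟨ count-cong (λ σ → cong (X (swapAt k σ) ∧_) (cong₂ _∧_ (swapAt-⊆ᵇ k τ σ)
         (cong₂ _≡ᵇ_ (∣swapAt∣ k σ) (cong suc (∣swapAt∣ k τ))))) (allSubsets n) ⟩
  count (λ σ → X (swapAt k σ) ∧ IsFacet τ σ) (allSubsets n) ∎))
  where open ≡-Reasoning

card-relabel : ∀ {n} k (X : Chain n) → card (relabel k X) ≡ card X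
card-relabel k X = sym (count-swapAt k X)

Collapsible-relabel : ∀ {n} k {F : Chain n} → Collapsible F → Collapsible (relabel k F)
Collapsible-relabel k (done empty) = done (empty ∘ swapAt k)
Collapsible-relabel k {F} (collapse σ τ Fσ τ⊆σ size free rest) =
  collapse (swapAt k σ) (swapAt k τ) (trans (cong F (swapAt-involutive k σ)) Fσ) (trans (swapAt-⊆ᵇ k τ σ) τ⊆σ)
    (trans (∣swapAt∣ k σ) (trans size (cong suc (sym (∣swapAt∣ k τ))))) free′
    (Collapsible-cong (Collapsible-relabel k rest) (λ ρ → cong (λ b → F (swapAt k ρ) ∧ not b) (swapAt-=ᵇ k ρ σ)))
  where
  free′ : ∀ ρ → F (swapAt k ρ) ≡ true → (swapAt k τ ⊆ᵇ ρ) ≡ true → ρ ≡ swapAt k σ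
  free′ ρ Fρ τ⊆ρ = trans (sym (swapAt-involutive k ρ)) (cong (swapAt k) (free (swapAt k ρ) Fρ
    (trans (sym (swapAt-⊆ᵇ k τ (swapAt k ρ))) (trans (cong (swapAt k τ ⊆ᵇ_) (swapAt-involutive k ρ)) τ⊆ρ))))

-- Binomial estimates.  DeficiencyBound m d c states C(m,d) - c ≤ C(m,d-2) without
-- subtraction (C(m,k) = 0 for k < 0); in the theorem m = n - 1 and c = |F|.

DeficiencyBound : ℕ → ℕ → ℕ → Set
DeficiencyBound m d c = m C d ≤ c + binomℤ m (d ⊖ 2)

pascal : ∀ m e → suc m C suc e ≡ m C e + m C suc e
pascal m e = sym (nCk+nC[k+1]≡[n+1]C[k+1] m e)

pascalℤ : ∀ m e → binomℤ (suc m) (suc e ⊖ 2) ≡ binomℤ m (e ⊖ 2) + binomℤ m (suc e ⊖ 2)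
pascalℤ m zero = refl
pascalℤ m (suc zero) = refl
pascalℤ m (suc (suc e)) = pascal m e

C-positive : ∀ k j → j ≤ k → 1 ≤ k C j
C-positive zero zero _ = ≤-refl
C-positive (suc k) zero _ = ≤-refl
C-positive (suc k) (suc j) (s≤s j≤k) = begin
  1                     ≤⟨ C-positive k j j≤k ⟩
  k C j                 ≤⟨ m≤m+n (k C j) (k C suc j) ⟩
  k C j + k C suc j     ≡⟨ sym (pascal k j) ⟩
  suc k C suc j         ∎
  where open ≤-Reasoning

C-unimodal : ∀ k i j → i ≤ j → i + j ≤ k → k C i ≤ k C j
C-unimodal zero zero zero _ _ = ≤-refl
C-unimodal (suc k) zero j _ j≤k = C-positive (suc k) j j≤k
C-unimodal (suc k) (suc i) (suc j) (s≤s i≤j) (s≤s i+j≤k) with suc i + suc j ≤? k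
... | yes below-middle = begin
  suc k C suc i         ≡⟨ pascal k i ⟩
  k C i + k C suc i     ≤⟨ +-mono-≤ (C-unimodal k i j i≤j (≤-trans (+-monoʳ-≤ i (n≤1+n j)) i+j≤k))
                                    (C-unimodal k (suc i) (suc j) (s≤s i≤j) below-middle) ⟩
  k C j + k C suc j     ≡⟨ sym (pascal k j) ⟩
  suc k C suc j         ∎
  where open ≤-Reasoning
... | no ¬below = ≤-reflexive (sym (begin-equality
  suc k C suc j             ≡⟨ nCk≡nC[n∸k] (m≤n⇒m≤1+n (≤-trans (m≤n+m (suc j) i) i+j≤k)) ⟩
  suc k C (suc k ∸ suc j)   ≡⟨ cong (λ x → suc k C (x ∸ j)) k≡i+1+j ⟩
  suc k C (i + suc j ∸ j)   ≡⟨ cong (λ x → suc k C (x ∸ j)) (+-suc i j) ⟩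
  suc k C (suc i + j ∸ j)   ≡⟨ cong (suc k C_) (m+n∸n≡m (suc i) j) ⟩
  suc k C suc i             ∎))
  where open ≤-Reasoning
        k≡i+1+j : k ≡ i + suc j
        k≡i+1+j = ≤-antisym (≤-pred (≰⇒> ¬below)) i+j≤k

C-small : ∀ m e → m ≤ 2 * e → m C suc e ≤ binomℤ m (suc e ⊖ 2)
C-small zero zero _ = z≤n
C-small m (suc f) m≤2e with suc (suc f) ≤? m
... | no f+2≰m = ≤-trans (≤-reflexive (k>n⇒nCk≡0 (≰⇒> f+2≰m))) z≤n
... | yes f+2≤m = begin
  m C suc (suc f)                 ≡⟨ nCk≡nC[n∸k] f+2≤m ⟩
  m C r                           ≤⟨ C-unimodal m r f r≤f r+f≤m ⟩
  m C f                           ∎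
  where
  open ≤-Reasoning
  r = m ∸ suc (suc f)
  f+2+r≡m : suc (suc f) + r ≡ m
  f+2+r≡m = m+[n∸m]≡n f+2≤m
  r+f≤m : r + f ≤ m
  r+f≤m = begin
    r + f            ≡⟨ +-comm r f ⟩
    f + r            ≤⟨ +-monoˡ-≤ r (≤-trans (n≤1+n f) (n≤1+n (suc f))) ⟩
    suc (suc f) + r  ≡⟨ f+2+r≡m ⟩
    m                ∎
  r≤f : r ≤ f
  r≤f = +-cancelˡ-≤ (suc (suc f)) r f (begin
    suc (suc f) + r              ≡⟨ f+2+r≡m ⟩
    m                            ≤⟨ m≤2e ⟩
    suc (f + (suc f + 0))        ≡⟨ cong (λ x → suc (f + x)) (+-identityʳ (suc f)) ⟩
    suc (f + suc f)              ≡⟨ cong suc (+-suc f f) ⟩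
    suc (suc f) + f              ∎)

-- Pascal's rule turns bounds for the link A (dimension e) and the deletion B (dimension e+1)
-- into a bound for 0 ∗ A + B on one more vertex.
bound-coneSum : ∀ m e cA cB → DeficiencyBound m e cA → DeficiencyBound m (suc e) cB →
  DeficiencyBound (suc m) (suc e) (cB + cA)
bound-coneSum m e cA cB boundA boundB = begin
  suc m C suc e                               ≡⟨ pascal m e ⟩
  m C e + m C suc e                           ≤⟨ +-mono-≤ boundA boundB ⟩
  (cA + below₂) + (cB + below₁)               ≡⟨ interchange cA below₂ cB below₁ ⟩
  (cA + cB) + (below₂ + below₁)               ≡⟨ cong₂ _+_ (+-comm cA cB) (sym (pascalℤ m e)) ⟩
  (cB + cA) + binomℤ (suc m) (suc e ⊖ 2)      ∎
  where
  open ≤-Reasoning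
  open CommSemigroupProperties +-commutativeSemigroup using (interchange)
  below₂ = binomℤ m (e ⊖ 2)
  below₁ = binomℤ m (suc e ⊖ 2)

bound-cone : ∀ m e cA → m ≤ 2 * e → DeficiencyBound m e cA → DeficiencyBound (suc m) (suc e) (0 + cA)
bound-cone m e cA m≤2e boundA = begin
  suc m C suc e                                        ≡⟨ pascal m e ⟩
  m C e + m C suc e                                    ≤⟨ +-mono-≤ boundA (C-small m e m≤2e) ⟩
  (cA + binomℤ m (e ⊖ 2)) + binomℤ m (suc e ⊖ 2)       ≡⟨ +-assoc cA _ _ ⟩
  cA + (binomℤ m (e ⊖ 2) + binomℤ m (suc e ⊖ 2))       ≡⟨ cong (λ x → cA + x) (sym (pascalℤ m e)) ⟩
  cA + binomℤ (suc m) (suc e ⊖ 2)                      ∎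
  where open ≤-Reasoning

Sized : ∀ {n} → ℕ → Chain n → Set
Sized k X = ∀ σ → X σ ≡ true → ∣ σ ∣ ≡ k

CollapsibleFilling : ∀ {n} → ℕ → Chain n → Chain n → Set
CollapsibleFilling d Z F = OfDim d F × Collapsible F × ∂ F ≐ Z

GoodFilling : ∀ {n} → ℕ → Chain n → Chain n → Set
GoodFilling {n} d Z F = CollapsibleFilling d Z F × DeficiencyBound (n ∸ 1) d (card F)

record Fillings {n : ℕ} (d : ℕ) (Z : Chain n) : Set where
  field
    forests  : List (Chain n)
    nonempty : 1 ≤ length forests
    many     : n ∸ 2 * d ≤ length forests
    good     : All (GoodFilling d Z) forests
    distinct : AllPairs Distinct forests

empty-fills : ∀ {n d} {X : Chain n} → Empty X → CollapsibleFilling d X ∅ᶜ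
empty-fills empty = (λ _ ()) , done (λ _ → refl) , λ τ → trans (∂-∅ τ) (sym (empty τ))

firstFilling : ∀ {n d} {Z : Chain n} → Fillings d Z → Σ (Chain n) (GoodFilling d Z)
firstFilling record { forests = F ∷ _ ; good = good ∷ _ } = F , good
firstFilling record { forests = [] ; nonempty = () }

GoodFilling-relabel : ∀ {n d} k {Z F : Chain n} → GoodFilling d (relabel k Z) F → GoodFilling d Z (relabel k F)
GoodFilling-relabel {n} {d} k {Z} {F} ((sized , collapsible , boundary) , bound) =
  ( (λ σ Fσ → trans (sym (∣swapAt∣ k σ)) (sized (swapAt k σ) Fσ))
  , Collapsible-relabel k collapsible
  , (λ τ → trans (∂-relabel k F τ) (trans (boundary (swapAt k τ)) (cong Z (swapAt-involutive k τ)))) )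
  , subst (DeficiencyBound (n ∸ 1) d) (sym (card-relabel k F)) bound

Distinct-relabel : ∀ {n} k {F G : Chain n} → Distinct F G → Distinct (relabel k F) (relabel k G)
Distinct-relabel k {F} {G} (σ , Fσ≢Gσ) =
  swapAt k σ , λ eq → Fσ≢Gσ (trans (cong F (sym (swapAt-involutive k σ))) (trans eq (cong G (swapAt-involutive k σ))))

-- fillings of relabel k Z, relabelled back, are fillings of Z (swapAt k is an involution)
Fillings-relabel : ∀ {n d} k {Z : Chain n} → Fillings d (relabel k Z) → Fillings d Z
Fillings-relabel {n} {d} k record { forests = Fs ; nonempty = nonempty ; many = many ; good = good ; distinct = distinct } =
  record
    { forests  = map (relabel k) Fs
    ; nonempty = subst (1 ≤_) (sym (length-map (relabel k) Fs)) nonempty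
    ; many     = subst (n ∸ 2 * d ≤_) (sym (length-map (relabel k) Fs)) many
    ; good     = All.map⁺ (All.map (GoodFilling-relabel k) good)
    ; distinct = AllPairs.map⁺ (AllPairs.map (Distinct-relabel k) distinct)
    }

point : ∀ {n} → Fin n → Chain n
point i ρ = ρ =ᵇ ⁅ i ⁆

sized₀-nonempty : ∀ {n} {Z : Chain n} → Sized 0 Z → Nonempty Z → ∀ τ → Z τ ≡ (∣ τ ∣ ≡ᵇ 0)
sized₀-nonempty {Z = Z} sized (σ , Zσ) τ with ∣ τ ∣ in size
... | zero = trans (cong Z (sym (⊆ᵇ-∣≡∣⇒≡ τ σ (∣∣≡0⇒⊆ᵇ τ σ size) (trans (sized σ Zσ) (sym size))))) Zσ
... | suc k = ¬-not (λ Zτ → 1+n≢0 (trans (sym size) (sized τ Zτ)))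

point-good : ∀ {m} {Z : Chain (suc m)} → Sized 0 Z → Nonempty Z → (i : Fin (suc m)) → GoodFilling 0 Z (point i)
point-good {m} {Z} sized nonempty i = (sized₁ , collapsible , boundary) , bound
  where
  sized₁ : OfDim 0 (point i)
  sized₁ ρ eq = trans (cong ∣_∣ (=ᵇ⇒≡ ρ ⁅ i ⁆ eq)) (∣⁅x⁆∣≡1 i)
  collapsible : Collapsible (point i)
  collapsible = collapse ⁅ i ⁆ ∅ (=ᵇ-refl ⁅ i ⁆) (∣∣≡0⇒⊆ᵇ ∅ ⁅ i ⁆ (∣⊥∣≡0 (suc m)))
    (trans (∣⁅x⁆∣≡1 i) (cong suc (sym (∣⊥∣≡0 (suc m))))) (λ ρ eq _ → =ᵇ⇒≡ ρ ⁅ i ⁆ eq)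
    (done (λ ρ → ∧-inverseʳ (ρ =ᵇ ⁅ i ⁆)))
  facet-of-point : ∀ τ → IsFacet τ ⁅ i ⁆ ≡ (∣ τ ∣ ≡ᵇ 0)
  facet-of-point τ rewrite ∣⁅x⁆∣≡1 i with ∣ τ ∣ in size
  ... | zero = cong (_∧ true) (∣∣≡0⇒⊆ᵇ τ ⁅ i ⁆ size)
  ... | suc k = ∧-zeroʳ (τ ⊆ᵇ ⁅ i ⁆)
  boundary : ∂ (point i) ≐ Z
  boundary τ = begin
    ∂ (point i) τ                        ≡⟨ ∂-unique (point i) τ ⁅ i ⁆ (λ ρ inc → =ᵇ⇒≡ ρ ⁅ i ⁆ (proj₁ (∧-true⁻ inc))) ⟩
    (⁅ i ⁆ =ᵇ ⁅ i ⁆) ∧ IsFacet τ ⁅ i ⁆   ≡⟨ cong (_∧ IsFacet τ ⁅ i ⁆) (=ᵇ-refl ⁅ i ⁆) ⟩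
    IsFacet τ ⁅ i ⁆                      ≡⟨ facet-of-point τ ⟩
    (∣ τ ∣ ≡ᵇ 0)                         ≡⟨ sym (sized₀-nonempty sized nonempty τ) ⟩
    Z τ                                  ∎
    where open ≡-Reasoning
  bound : DeficiencyBound m 0 (card (point i))
  bound rewrite count-unique ⁅ i ⁆ (point i) (λ ρ eq → =ᵇ⇒≡ ρ ⁅ i ⁆ eq) | =ᵇ-refl ⁅ i ⁆ = ≤-refl

point-distinct : ∀ {n} {i j : Fin n} → i ≢ j → Distinct (point i) (point j)
point-distinct {i = i} {j} i≢j = ⁅ i ⁆ , λ eq → i≢j (x∈⁅y⁆⇒x≡y j (subst (i ∈_) (⁅i⁆≡⁅j⁆ eq) (x∈⁅x⁆ i)))
  where ⁅i⁆≡⁅j⁆ : point i ⁅ i ⁆ ≡ point j ⁅ i ⁆ → ⁅ i ⁆ ≡ ⁅ j ⁆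
        ⁅i⁆≡⁅j⁆ eq = =ᵇ⇒≡ ⁅ i ⁆ ⁅ j ⁆ (trans (sym eq) (=ᵇ-refl ⁅ i ⁆))

fillings₀ : ∀ {m} (Z : Chain (suc m)) → Sized 0 Z → Nonempty Z → Fillings 0 Z
fillings₀ {m} Z sized nonempty = record
  { forests  = tabulate point
  ; nonempty = subst (1 ≤_) (sym (length-tabulate {n = suc m} point)) (s≤s z≤n)
  ; many     = ≤-reflexive (sym (length-tabulate {n = suc m} point))
  ; good     = All.tabulate⁺ (point-good sized nonempty)
  ; distinct = AllPairs.tabulate⁺ point-distinct
  }

LiesOver : ∀ {n} → Chain (suc n) → Chain n → Set
LiesOver F A = link F ≐ A

LiesOver-distinct : ∀ {n} {F G : Chain (suc n)} {A B : Chain n} → LiesOver F A → LiesOver G B → Distinct A B → Distinct F G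
LiesOver-distinct F/A G/B (σ , Aσ≢Bσ) = true ∷ σ , λ eq → Aσ≢Bσ (trans (sym (F/A σ)) (trans eq (G/B σ)))

module Lifting {n : ℕ} (P Ok : Chain n → Set) (Q : Chain (suc n) → Set)
               (lift : ∀ A → P A → Ok A → Σ (Chain (suc n)) λ F → Q F × LiesOver F A) where

  Lifted : List (Chain n) → Set
  Lifted As = Σ (List (Chain (suc n))) λ Fs → All Q Fs × AllPairs Distinct Fs × All (λ F → Any (LiesOver F) As) Fs

  distinct-from : ∀ {F : Chain (suc n)} {A As Gs} → LiesOver F A → All (Distinct A) As →
    All (λ G → Any (LiesOver G) As) Gs → All (Distinct F) Gs
  distinct-from F/A A≢As = All.map λ G/As → let A≢B , G/B = All.lookupAny A≢As G/As in LiesOver-distinct F/A G/B A≢B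

  liftAll : ∀ As → All P As → All Ok As → AllPairs Distinct As → Σ (Lifted As) λ L → length (proj₁ L) ≡ length As
  liftAll [] [] [] [] = ([] , [] , [] , []) , refl
  liftAll (A ∷ As) (p ∷ ps) (ok ∷ oks) (A≢As ∷ distinct) with lift A p ok | liftAll As ps oks distinct
  ... | F , q , F/A | (Fs , qs , distinctFs , over) , len =
    (F ∷ Fs , q ∷ qs , distinct-from F/A A≢As over ∷ distinctFs , here F/A ∷ All.map there over) , cong suc len

  liftAllButOne : ∀ As → All P As → AllPairs Distinct As → (∀ A → Ok A ⊎ (∀ A′ → Distinct A A′ → Ok A′)) →
    Σ (Lifted As) λ L → length As ≤ suc (length (proj₁ L))
  liftAllButOne [] [] [] _ = ([] , [] , [] , []) , z≤n
  liftAllButOne (A ∷ As) (p ∷ ps) (A≢As ∷ distinct) okOrOthers with okOrOthers A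
  ... | inj₁ ok with lift A p ok | liftAllButOne As ps distinct okOrOthers
  ...   | F , q , F/A | (Fs , qs , distinctFs , over) , len =
    (F ∷ Fs , q ∷ qs , distinct-from F/A A≢As over ∷ distinctFs , here F/A ∷ All.map there over) , s≤s len
  liftAllButOne (A ∷ As) (p ∷ ps) (A≢As ∷ distinct) okOrOthers | inj₂ othersOk
    with liftAll As ps (All.map (othersOk _) A≢As) distinct
  ... | (Fs , qs , distinctFs , over) , len = (Fs , qs , distinctFs , All.map there over) , s≤s (≤-reflexive (sym len))

-- Let Z be a cycle of (e+1)-sets on {0} ⊔ [m+1] with nonempty link at 0.
-- For a good filling A of the link, the residual (deletion Z) + A is a cycle avoiding 0.
-- If it is nonempty, a good filling B of it yields the good filling 0 ∗ A + B of Z; if it is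
-- empty, 0 ∗ A fills Z, with the deficiency bound as long as m ≤ 2e.
module ConeStep {m e : ℕ} (Z : Chain (suc (suc m))) (sized : Sized (suc e) Z) (cyc : IsCycle Z)
  (fillings : ∀ d (X : Chain (suc m)) → Sized d X → IsCycle X → Nonempty X → Fillings d X) where

  -- the cycle that the deletion part of a filling over A must fill
  residual : Chain (suc m) → Chain (suc m)
  residual A = deletion Z ⊕ A

  residual-sized : ∀ {A} → OfDim e A → Sized (suc e) (residual A)
  residual-sized {A} sizedA s eq with deletion Z s in Z₀s
  ... | true = sized (false ∷ s) Z₀s
  ... | false = sizedA s eq

  residual-cycle : ∀ {A} → ∂ A ≐ link Z → IsCycle (residual A)
  residual-cycle {A} ∂A τ = begin
    ∂ (deletion Z ⊕ A) τ          ≡⟨ ∂-⊕ (deletion Z) A τ ⟩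
    ∂ (deletion Z) τ xor ∂ A τ    ≡⟨ cong₂ _xor_ (link-boundary Z cyc τ) (∂A τ) ⟩
    link Z τ xor link Z τ         ≡⟨ xor-same (link Z τ) ⟩
    false                         ∎
    where open ≡-Reasoning

  -- Distinct chains have distinct residuals, so at most one residual is empty.
  residual-distinct : ∀ {A A′} → Empty (residual A) → Distinct A A′ → Nonempty (residual A′)
  residual-distinct {A} {A′} empty (σ , Aσ≢A′σ) =
    σ , trans (cong (_xor A′ σ) (xor≡false⇒≡ {deletion Z σ} {A σ} (empty σ))) (≢⇒xor-true Aσ≢A′σ)
    where ≢⇒xor-true : ∀ {a b} → a ≢ b → (a xor b) ≡ true
          ≢⇒xor-true {true} {true} a≢b = ⊥-elim (a≢b refl)
          ≢⇒xor-true {true} {false} _ = refl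
          ≢⇒xor-true {false} {true} _ = refl
          ≢⇒xor-true {false} {false} a≢b = ⊥-elim (a≢b refl)

  coneSum-fills : ∀ {A B} → CollapsibleFilling e (link Z) A → CollapsibleFilling (suc e) (residual A) B →
    CollapsibleFilling (suc e) Z (coneSum A B)
  coneSum-fills {A} {B} (sizedA , collapsibleA , ∂A) (sizedB , collapsibleB , ∂B) =
    sizedAB , collapsible-coneSum collapsibleA collapsibleB , boundary
    where
    sizedAB : OfDim (suc e) (coneSum A B)
    sizedAB (false ∷ s) eq = sizedB s eq
    sizedAB (true ∷ s) eq = cong suc (sizedA s eq)
    boundary : ∂ (coneSum A B) ≐ Z
    boundary (true ∷ t) = trans (∂-coneSum-link A B t) (∂A t)
    boundary (false ∷ t) = begin
      ∂ (coneSum A B) (false ∷ t)      ≡⟨ ∂-coneSum-deletion A B t ⟩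
      ∂ B t xor A t                    ≡⟨ cong (_xor A t) (∂B t) ⟩
      (deletion Z t xor A t) xor A t   ≡⟨ xor-assoc (deletion Z t) (A t) (A t) ⟩
      deletion Z t xor (A t xor A t)   ≡⟨ cong (deletion Z t xor_) (xor-same (A t)) ⟩
      deletion Z t xor false           ≡⟨ xor-identityʳ (deletion Z t) ⟩
      Z (false ∷ t)                    ∎
      where open ≡-Reasoning

  good-coneSum : ∀ {A B} → GoodFilling e (link Z) A → GoodFilling (suc e) (residual A) B →
    GoodFilling (suc e) Z (coneSum A B)
  good-coneSum {A} {B} (fillA , boundA) (fillB , boundB) =
    coneSum-fills fillA fillB ,
    subst (DeficiencyBound (suc m) (suc e)) (sym (card-coneSum A B)) (bound-coneSum m e _ _ boundA boundB)

  good-cone : ∀ {A} → GoodFilling e (link Z) A → Empty (residual A) → m ≤ 2 * e → GoodFilling (suc e) Z (coneSum A ∅ᶜ)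
  good-cone {A} (fillA , boundA) empty m≤2e =
    coneSum-fills fillA (empty-fills empty) ,
    subst (DeficiencyBound (suc m) (suc e)) (sym card-cone) (bound-cone m e _ m≤2e boundA)
    where card-cone : card (coneSum A ∅ᶜ) ≡ 0 + card A
          card-cone = trans (card-coneSum A ∅ᶜ) (cong (_+ card A) (count-none (λ _ → refl) (allSubsets (suc m))))

  -- A can be lifted when its residual is nonempty (so that it has a good filling B),
  -- or when m ≤ 2e (so that the cone 0 ∗ A suffices if the residual is empty).
  Liftable : Chain (suc m) → Set
  Liftable A = Nonempty (residual A) ⊎ m ≤ 2 * e

  lift : ∀ A → GoodFilling e (link Z) A → Liftable A →
    Σ (Chain (suc (suc m))) λ F → GoodFilling (suc e) Z F × LiesOver F A
  lift A goodA@((sizedA , _ , ∂A) , _) liftable with nonempty⊎empty (residual A) | liftable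
  ... | inj₁ nonempty | _ =
    let B , goodB = firstFilling (fillings (suc e) (residual A) (residual-sized sizedA) (residual-cycle ∂A) nonempty)
    in coneSum A B , good-coneSum goodA goodB , λ _ → refl
  ... | inj₂ empty | inj₁ (σ , residualσ) with () ← trans (sym residualσ) (empty σ)
  ... | inj₂ empty | inj₂ m≤2e = coneSum A ∅ᶜ , good-cone goodA empty m≤2e , λ _ → refl

  open Lifting (GoodFilling e (link Z)) Liftable (GoodFilling (suc e) Z) lift

  n∸2d≡m∸2e : suc (suc m) ∸ 2 * suc e ≡ m ∸ 2 * e
  n∸2d≡m∸2e = cong (suc (suc m) ∸_) (*-suc 2 e)

  -- For m ≤ 2e every good filling of the link lifts and one is enough; otherwise at most one
  -- of the ≥ m + 1 - 2e fillings of the link is lost, leaving ≥ m - 2e ≥ 1.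
  fillings-cone : Nonempty (link Z) → Fillings (suc e) Z
  fillings-cone nonemptyL
    with fillings e (link Z) (λ s → suc-injective ∘ sized (true ∷ s)) (link-cycle Z cyc) nonemptyL | m ≤? 2 * e
  ... | record { forests = As ; nonempty = nonemptyAs ; good = goodAs ; distinct = distinctAs } | yes m≤2e =
    let (Fs , goodFs , distinctFs , _) , len = liftAll As goodAs (All.map (λ _ → inj₂ m≤2e) goodAs) distinctAs
    in record { forests = Fs ; nonempty = subst (1 ≤_) (sym len) nonemptyAs
              ; many = subst (_≤ length Fs) (sym (trans n∸2d≡m∸2e (m≤n⇒m∸n≡0 m≤2e))) z≤n
              ; good = goodFs ; distinct = distinctFs }
  ... | record { forests = As ; many = manyAs ; good = goodAs ; distinct = distinctAs } | no m≰2e =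
    let (Fs , goodFs , distinctFs , _) , len = liftAllButOne As goodAs distinctAs liftable-or-others
        many = m∸2e≤length (≤-trans manyAs len)
    in record { forests = Fs ; nonempty = ≤-trans (m<n⇒0<n∸m (≰⇒> m≰2e)) many
              ; many = subst (_≤ length Fs) (sym n∸2d≡m∸2e) many
              ; good = goodFs ; distinct = distinctFs }
    where
    liftable-or-others : ∀ A → Liftable A ⊎ (∀ A′ → Distinct A A′ → Liftable A′)
    liftable-or-others A with nonempty⊎empty (residual A)
    ... | inj₁ nonempty = inj₁ (inj₁ nonempty)
    ... | inj₂ empty = inj₂ λ A′ → inj₁ ∘ residual-distinct empty
    m∸2e≤length : ∀ {L} → suc m ∸ 2 * e ≤ suc L → m ∸ 2 * e ≤ L
    m∸2e≤length {L} = ∸-pred m (2 * e) L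
      where ∸-pred : ∀ a b c → suc a ∸ b ≤ suc c → a ∸ b ≤ c
            ∸-pred a zero c le = ≤-pred le
            ∸-pred zero (suc b) c le = z≤n
            ∸-pred (suc a) (suc b) c le = ∸-pred a b c le

HasVertex : ∀ {n} → ℕ → Subset n → Set
HasVertex k [] = ⊥
HasVertex zero (a ∷ s) = a ≡ true
HasVertex (suc k) (a ∷ s) = HasVertex k s

vertexOf : ∀ {n e} (σ : Subset n) → ∣ σ ∣ ≡ suc e → Σ ℕ λ k → HasVertex k σ
vertexOf (true ∷ s) _ = zero , refl
vertexOf (false ∷ s) size = let k , k∈s = vertexOf s size in suc k , k∈s

HasVertex-swapAt : ∀ {n} k (σ : Subset n) → HasVertex (suc k) σ → HasVertex k (swapAt k σ)
HasVertex-swapAt zero (a ∷ b ∷ s) b∈σ = b∈σ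
HasVertex-swapAt (suc k) (a ∷ s) k∈s = HasVertex-swapAt k s k∈s

one-vertex-link : ∀ {e} (Z : Chain 1) → Sized (suc e) Z → IsCycle Z → Empty (link Z)
one-vertex-link Z sized cyc [] = begin
  link Z []            ≡⟨ sym (link-boundary Z cyc []) ⟩
  ∂ (deletion Z) []    ≡⟨ ∂-cong deletion-empty [] ⟩
  ∂ ∅ᶜ []              ≡⟨ ∂-∅ [] ⟩
  false                ∎
  where
  open ≡-Reasoning
  deletion-empty : deletion Z ≐ ∅ᶜ
  deletion-empty [] = ¬-not λ Z∅ → 0≢1+n (sized (false ∷ []) Z∅)

fillings : ∀ m d (Z : Chain (suc m)) → Sized d Z → IsCycle Z → Nonempty Z → Fillings d Z
fillings-through : ∀ m e k (Z : Chain (suc m)) → Sized (suc e) Z → IsCycle Z →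
  (σ : Subset (suc m)) → Z σ ≡ true → HasVertex k σ → Fillings (suc e) Z

fillings m zero Z sized cyc nonempty = fillings₀ Z sized nonempty
fillings m (suc e) Z sized cyc (σ , Zσ) =
  let k , k∈σ = vertexOf σ (sized σ Zσ) in fillings-through m e k Z sized cyc σ Zσ k∈σ

fillings-through zero e zero Z sized cyc (true ∷ []) Zσ refl with () ← trans (sym Zσ) (one-vertex-link Z sized cyc [])
fillings-through (suc m) e zero Z sized cyc (true ∷ s) Zσ refl = ConeStep.fillings-cone Z sized cyc (fillings m) (s , Zσ)
fillings-through m e (suc k) Z sized cyc σ Zσ k∈σ =
  Fillings-relabel k (fillings-through m e k (relabel k Z) sized′ cyc′ (swapAt k σ) Z′σ′ (HasVertex-swapAt k σ k∈σ))
  where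
  Z′σ′ : relabel k Z (swapAt k σ) ≡ true
  Z′σ′ = trans (cong Z (swapAt-involutive k σ)) Zσ
  sized′ : Sized (suc e) (relabel k Z)
  sized′ ρ eq = trans (sym (∣swapAt∣ k ρ)) (sized (swapAt k ρ) eq)
  cyc′ : IsCycle (relabel k Z)
  cyc′ τ = trans (∂-relabel k Z τ) (cyc (swapAt k τ))

deficiency-ℤ : ∀ a b c → a ≤ c + b → (+ a - + c) ≤ℤ + b
deficiency-ℤ a b c a≤c+b with c ≤? a
... | yes c≤a = subst (_≤ℤ + b) (sym (trans (m-n≡m⊖n a c) (⊖-≥ c≤a))) (+≤+ (m≤n+o⇒m∸n≤o a c a≤c+b))
... | no c≰a = subst (_≤ℤ + b) (sym (trans (m-n≡m⊖n a c) (⊖-≤ (<⇒≤ (≰⇒> c≰a))))) neg-≤-pos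

good⇒required : ∀ {n d} {Z F : Chain n} → GoodFilling d Z F →
  IsForest d F × Collapsible F × (∀ τ → ∂ F τ ≡ Z τ) × ((+ ((n ∸ 1) C d) - + card F) ≤ℤ + binomℤ (n ∸ 1) (d ⊖ 2))
good⇒required {n} {d} {F = F} ((sized , collapsible , boundary) , bound) =
  (sized , collapsible⇒acyclic collapsible) , collapsible , boundary , deficiency-ℤ _ _ (card F) bound

theorem2 : (d n : ℕ) → 1 ≤ d → 1 ≤ n → (Z : Chain n) → OfDim (d ∸ 1) Z → IsCycle Z → Nonempty Z →
    let Good : Chain n → Set
        Good F = IsForest d F × Collapsible F × (∀ τ → ∂ F τ ≡ Z τ) × ((+ ((n ∸ 1) C d) - + card F) ≤ℤ + binomℤ (n ∸ 1) (d ⊖ 2))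
    in (∃ λ F → Good F) × (Σ (List (Chain n)) λ Fs → (n ∸ 2 * d ≤ length Fs) × All Good Fs × AllPairs Distinct Fs)
theorem2 (suc e) (suc m) (s≤s z≤n) (s≤s z≤n) Z sized cyc nonempty =
  (F₀ , good⇒required good₀) , forests , many , All.map good⇒required good , distinct
  where
  all-fillings : Fillings (suc e) Z
  all-fillings = fillings m (suc e) Z sized cyc nonempty
  open Fillings all-fillings
  F₀ : Chain (suc m)
  F₀ = proj₁ (firstFilling all-fillings)
  good₀ : GoodFilling (suc e) Z F₀
  good₀ = proj₂ (firstFilling all-fillings)
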